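{- Every natural space is spreadlike. In fact, for every natural space $(\mathcal V,\mathcal T_\#)$ there is a pre-apartness $\#'$ on $\mathbb N^*$ such that $(\mathbb N^*,\#',\preccurlyeq_\omega)$ is a pre-natural space whose natural space is a spread isomorphic to $(\mathcal V,\mathcal T_\#)$.
   Context: Setting: Bishop-style constructive mathematics. Pre-natural space $(V,\#,\preccurlyeq)$: $V$ countable, $\#,\preccurlyeq$ decidable, $\#$ symmetric irreflexive, $\preccurlyeq$ partial order, $a\preccurlyeq b\wedge c\#b\Rightarrow c\#a$; $a\prec b$ means $a\preccurlyeq b,a\ne b$. Points: sequences $(p_n)$ in $V$ with $p_{n+1}\preccurlyeq p_n$, each $n$ some $m$ with $p_m\prec p_n$, for every $a\#b$ some $m$ with $p_m\#a$ or $p_m\#b$; $\mathcal V$ = points; $p\#q$ iff $\exists n\,p_n\#q_n$; $p\equiv q$ iff not $p\#q$; $\hat a=\{p:\exists m\,p_m\prec a\}$; apartness topology: $U$ open iff for all $x\in U,y\in\mathcal V$ one can determine $y\#x$ or $\widehat{y_m}\subseteq U$ for some $m$. Natural space: a maximal dot $\top$ exists and each $\hat a$ is inhabited. $\mathbb N^*$ is the set of finite sequences of natural numbers, with $b\preccurlyeq_\omega a$ iff $b=a\star c$ for some $c$ ($\star$ concatenation); the empty sequence is maximal. Morphisms: refinement morphism $f:V\to W$ with $f(a)\#f(b)\Rightarrow a\#b$, $a\preccurlyeq b\Rightarrow f(a)\preccurlyeq f(b)$, points to points. Trail morphism: refinement morphism from the trail space (basic dots: finite sequences $p_0,\dots,p_{n-1}$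 of points $p$ with repetitions deleted, ordered by "extends", apart iff last elements apart), acting on points via these trails. Natural morphism: refinement or trail morphism; isomorphism: morphism $f$ with a morphism $g$ back such that $g\circ f$ and $f\circ g$ are $\equiv$ the identity on points. $(V,\preccurlyeq)$ is a tree if every $a$ has finitely many $b$ with $a\preccurlyeq b$ and there is a unique chain of immediate successors from $\top$ to $a$ ($a$ is an immediate successor of $c$ if $a\prec c$ and no $b$ has $a\prec b\prec c$). A natural space is a spread if $(V,\preccurlyeq)$ is a tree and every infinite strictly decreasing sequence in $V$ is a point; it is spreadlike if it is isomorphic to a spread. -}

module Defs where

open import Data.Nat using (ℕ; zero; suc)
open import Data.List using (List; []; _∷_; _++_)
open import Data.List.Membership.Propositional using (_∈_)
open import Data.Product using (Σ; ∃; _×_; _,_; proj₁)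
open import Data.Sum using (_⊎_)
open import Data.Empty using (⊥)
open import Relation.Nullary using (¬_; Dec; yes; no)
open import Relation.Binary.PropositionalEquality using (_≡_; refl)
open import Function using (_∘_; _⇔_)

module Raw {D : Set} (_#_ : D → D → Set) (_≼_ : D → D → Set) where

  _≺_ : D → D → Set
  a ≺ b = (a ≼ b) × ¬ (a ≡ b)

  IsPoint : (ℕ → D) → Set
  IsPoint p =
      (∀ n → p (suc n) ≼ p n)
    × (∀ n → ∃ λ m → p m ≺ p n)
    × (∀ a b → a # b → ∃ λ m → (p m # a) ⊎ (p m # b))

  _#ₚ_ : (ℕ → D) → (ℕ → D) → Set
  p #ₚ q = ∃ λ n → p n # q n

  _≡ₚ_ : (ℕ → D) → (ℕ → D) → Set
  p ≡ₚ q = ¬ (p #ₚ q)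

  _∈̂_ : (ℕ → D) → D → Set
  p ∈̂ a = ∃ λ m → p m ≺ a

  ImmSucc : D → D → Set
  ImmSucc b c = (b ≺ c) × (∀ x → ¬ ((b ≺ x) × (x ≺ c)))

  data ChainTo : D → D → List D → Set where
    here  : ∀ {a} → ChainTo a a []
    step  : ∀ {c b a l} → ImmSucc b c → ChainTo b a l → ChainTo c a (b ∷ l)

  IsTree : D → Set
  IsTree ⊤ =
      (∀ a → Σ (List D) λ bs → ∀ b → (b ∈ bs) ⇔ (a ≼ b))
    × (∀ a → Σ (List D) λ l → ChainTo ⊤ a l
               × (∀ l′ → ChainTo ⊤ a l′ → l′ ≡ l))

  StrictDecIsPoint : Set
  StrictDecIsPoint = ∀ (s : ℕ → D) → (∀ n → s (suc n) ≺ s n) → IsPoint s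

record IsPreNatural {D : Set} (_#_ : D → D → Set) (_≼_ : D → D → Set) : Set where
  field
    countable : Σ (ℕ → D) λ e → ∀ a → ∃ λ n → e n ≡ a
    #-dec     : ∀ a b → Dec (a # b)
    ≼-dec     : ∀ a b → Dec (a ≼ b)
    #-sym     : ∀ {a b} → a # b → b # a
    #-irrefl  : ∀ {a} → ¬ (a # a)
    ≼-refl    : ∀ {a} → a ≼ a
    ≼-trans   : ∀ {a b c} → a ≼ b → b ≼ c → a ≼ c
    ≼-antisym : ∀ {a b} → a ≼ b → b ≼ a → a ≡ b
    ≼-#       : ∀ {a b c} → a ≼ b → c # b → c # a

record PreNatural : Set₁ where
  field
    V    : Set
    _#_  : V → V → Set
    _≼_  : V → V → Set
    isPreNatural : IsPreNatural _#_ _≼_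
  open IsPreNatural isPreNatural public
  open Raw _#_ _≼_ public

  _≟_ : ∀ (a b : V) → Dec (a ≡ b)
  a ≟ b with ≼-dec a b | ≼-dec b a
  ... | yes ab | yes ba = yes (≼-antisym ab ba)
  ... | no ¬ab | _      = no λ { refl → ¬ab ≼-refl }
  ... | yes _  | no ¬ba = no λ { refl → ¬ba ≼-refl }

  IsNatural : Set
  IsNatural = (Σ V λ ⊤ → ∀ a → a ≼ ⊤)
            × (∀ a → ∃ λ (p : ℕ → V) → IsPoint p × (p ∈̂ a))

  IsSpread : IsNatural → Set
  IsSpread nat = IsTree (proj₁ (proj₁ nat)) × StrictDecIsPoint

  -- Trail space.  A trail is stored in reverse: the head of the list is
  -- the LAST element of the finite sequence.

  consIfNew : V → List V → List V
  consIfNew a [] = a ∷ []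
  consIfNew a (b ∷ t) with a ≟ b
  ... | yes _ = b ∷ t
  ... | no  _ = a ∷ b ∷ t

  trailOf : (ℕ → V) → ℕ → List V
  trailOf p zero    = []
  trailOf p (suc n) = consIfNew (p n) (trailOf p n)

  IsTrailDot : List V → Set
  IsTrailDot t = ∃ λ (p : ℕ → V) → IsPoint p × ∃ λ n → trailOf p n ≡ t

  -- t extends s  (in reversed representation: s is a suffix of t)
  _≼ᵗ_ : List V → List V → Set
  t ≼ᵗ s = ∃ λ c → t ≡ c ++ s

  _#ᵗ_ : List V → List V → Set
  (a ∷ _) #ᵗ (b ∷ _) = a # b
  _       #ᵗ _       = ⊥

  module Trail = Raw _#ᵗ_ _≼ᵗ_

module _ (S T : PreNatural) where
  private
    module S = PreNatural S
    module T = PreNatural T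

  record IsRefinementMorphism (f : S.V → T.V) : Set where
    field
      #-reflect  : ∀ a b → f a T.# f b → a S.# b
      ≼-preserve : ∀ a b → a S.≼ b → f a T.≼ f b
      points     : ∀ p → S.IsPoint p → T.IsPoint (f ∘ p)

  -- a refinement morphism from the trail space of S to T
  record IsTrailMorphism (f : List S.V → T.V) : Set where
    field
      #-reflect  : ∀ t s → S.IsTrailDot t → S.IsTrailDot s
                   → f t T.# f s → t S.#ᵗ s
      ≼-preserve : ∀ t s → S.IsTrailDot t → S.IsTrailDot s
                   → t S.≼ᵗ s → f t T.≼ f s
      points     : ∀ (P : ℕ → List S.V) → (∀ n → S.IsTrailDot (P n))
                   → S.Trail.IsPoint P → T.IsPoint (f ∘ P)

  Morphism : Set
  Morphism = (Σ (S.V → T.V) IsRefinementMorphism)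
           ⊎ (Σ (List S.V → T.V) IsTrailMorphism)

  act : Morphism → (ℕ → S.V) → (ℕ → T.V)
  act (Data.Sum.inj₁ (f , _)) p = f ∘ p
  act (Data.Sum.inj₂ (f , _)) p = λ n → f (S.trailOf p n)

Iso : PreNatural → PreNatural → Set
Iso S T = Σ (Morphism S T) λ f → Σ (Morphism T S) λ g →
    (∀ p → PreNatural.IsPoint S p → PreNatural._≡ₚ_ S (act T S g (act S T f p)) p)
  × (∀ q → PreNatural.IsPoint T q → PreNatural._≡ₚ_ T (act S T f (act T S g q)) q)

_≼ω_ : List ℕ → List ℕ → Set
b ≼ω a = ∃ λ c → b ≡ a ++ c

ℕ*Space : (_#′_ : List ℕ → List ℕ → Set) → IsPreNatural _#′_ _≼ω_ → PreNatural
ℕ*Space _#′_ ax = record { V = List ℕ ; _#_ = _#′_ ; _≼_ = _≼ω_ ; isPreNatural = ax }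

-- Fix an enumeration of V and of all pairs of dots. A finite sequence of naturals
-- n₀ ⋯ n_{k-1} is read as a path from ⊤ down through V: at stage k the candidate
-- dot enum n_k is accepted if it lies strictly below the current dot and separates
-- the k-th pair, and otherwise a fixed such dot (which exists because the space is
-- natural) is taken. Decoding sends ℕ* onto these paths, and pulling the apartness
-- back along it gives a spread: ℕ* ordered by extension is a tree, and an infinite
-- descending path gets arbitrarily long, so it separates every apart pair.
-- Conversely a trail of a point is encoded greedily, keeping exactly the dots that
-- are admissible at the current stage; deep enough dots of a point are admissible,
-- so the code of a trail point grows without bound. Decoding after encoding stays
-- above the point, which makes both composites equivalent to the identity.
module Submission where

open import Defs
open import Data.Nat using (ℕ; zero; suc; _+_; _<_; _≤_; _≤′_; ≤′-refl; ≤′-step; z≤n; s≤s)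
import Data.Nat.Properties as ℕ
open import Data.List using (List; []; _∷_; _++_; _∷ʳ_; [_]; length; map)
open import Data.List.Properties
  using (++-identityʳ; ++-identityʳ-unique; ++-identityˡ-unique; ++-assoc; ++-cancelˡ;
         ++-conicalˡ; ++-conicalʳ; length-++; length-++-sucʳ; length-++-≤ˡ)
open import Data.List.Membership.Propositional using (_∈_)
open import Data.List.Membership.Propositional.Properties using (∈-map⁺; ∈-map⁻)
open import Data.List.Relation.Unary.Any using (here; there)
open import Data.List.Relation.Unary.All as All using (All; []; _∷_)
import Data.List.Relation.Unary.All.Properties as All
open import Data.List.Relation.Unary.AllPairs using (AllPairs; []; _∷_)
open import Data.Product as Product using (Σ; ∃; _×_; _,_; proj₁; proj₂; uncurry)
open import Data.Sum as Sum using (_⊎_; inj₁; inj₂)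
open import Data.Empty using (⊥-elim)
open import Function using (_∘_)
open import Function.Bundles using (mk⇔)
open import Relation.Nullary using (¬_; Dec; yes; no)
open import Relation.Nullary.Decidable using (_×-dec_; _⊎-dec_; _→-dec_; ¬?)
open import Relation.Binary.Definitions using (Reflexive; Transitive)
open import Relation.Binary.PropositionalEquality
  using (_≡_; _≢_; refl; sym; trans; cong; subst)
import Relation.Binary.Construct.NonStrictToStrict as Strict

-- Cantor's enumeration of ℕ × ℕ, walking each anti-diagonal from (d , 0) to (0 , d).
nextPair : ℕ × ℕ → ℕ × ℕ
nextPair (zero  , j) = suc j , 0
nextPair (suc i , j) = i , suc j

unpair : ℕ → ℕ × ℕ
unpair zero    = 0 , 0
unpair (suc k) = nextPair (unpair k)

unpair-surjective : ∀ i j → ∃ λ k → unpair k ≡ (i , j)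
unpair-surjective i j = onDiagonal (j + i) j i refl
  where
  onDiagonal : ∀ d j i → j + i ≡ d → ∃ λ k → unpair k ≡ (i , j)
  onDiagonal _       zero    zero    _  = 0 , refl
  onDiagonal zero    zero    (suc i) ()
  onDiagonal (suc d) zero    (suc i) eq =
    Product.map suc (cong nextPair) (onDiagonal d i zero (trans (ℕ.+-identityʳ i) (ℕ.suc-injective eq)))
  onDiagonal d       (suc j) i       eq =
    Product.map suc (cong nextPair) (onDiagonal d j (suc i) (trans (ℕ.+-suc j i) eq))

decodeList : ℕ → ℕ → List ℕ
decodeList zero    _ = []
decodeList (suc l) k = proj₁ (unpair k) ∷ decodeList l (proj₂ (unpair k))

decodeList-surjective : ∀ xs → ∃ λ k → decodeList (length xs) k ≡ xs
decodeList-surjective []       = 0 , refl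
decodeList-surjective (x ∷ xs) =
  let k , dk = decodeList-surjective xs
      j , uj = unpair-surjective x k
  in j , trans (cong (λ p → proj₁ p ∷ decodeList (length xs) (proj₂ p)) uj) (cong (x ∷_) dk)

ℕ*-countable : Σ (ℕ → List ℕ) λ e → ∀ xs → ∃ λ n → e n ≡ xs
ℕ*-countable = uncurry decodeList ∘ unpair , λ xs →
  let k , dk = decodeList-surjective xs
      n , un = unpair-surjective (length xs) k
  in n , trans (cong (uncurry decodeList) un) dk

xs++y∷ys≢xs : ∀ {A : Set} (xs : List A) y ys → xs ++ y ∷ ys ≢ xs
xs++y∷ys≢xs xs y ys eq with ++-identityʳ-unique xs (sym eq)
... | ()

splitAt-<length : ∀ {A : Set} K (w : List A) → K < length w →
                  ∃ λ u → ∃ λ x → ∃ λ w′ → w ≡ u ++ x ∷ w′ × length u ≡ K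
splitAt-<length zero    (x ∷ w) _        = [] , x , w , refl , refl
splitAt-<length (suc K) (y ∷ w) (s≤s K<) with splitAt-<length K w K<
... | u , x , w′ , refl , refl = y ∷ u , x , w′ , refl , refl

stepwise⇒antitone : ∀ {D : Set} {R : D → D → Set} → Reflexive R → Transitive R →
  (s : ℕ → D) → (∀ n → R (s (suc n)) (s n)) → ∀ {m n} → m ≤ n → R (s n) (s m)
stepwise⇒antitone {R = R} R-refl R-trans s step {m} m≤n = go (ℕ.≤⇒≤′ m≤n)
  where
  go : ∀ {n} → m ≤′ n → R (s n) (s m)
  go ≤′-refl        = R-refl
  go (≤′-step m≤′n) = R-trans (step _) (go m≤′n)

_≺ω_ : List ℕ → List ℕ → Set
a ≺ω b = a ≼ω b × a ≢ b

≼ω-refl : ∀ {a} → a ≼ω a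
≼ω-refl {a} = [] , sym (++-identityʳ a)

≼ω-trans : ∀ {a b c} → a ≼ω b → b ≼ω c → a ≼ω c
≼ω-trans {c = c} (d , refl) (e , refl) = e ++ d , ++-assoc c e d

≼ω-antisym : ∀ {a b} → a ≼ω b → b ≼ω a → a ≡ b
≼ω-antisym {b = b} (d , refl) (e , eq)
  with ++-conicalˡ d e (++-identityʳ-unique b (trans eq (++-assoc b d e)))
... | refl = ++-identityʳ b

_≼ω?_ : ∀ a b → Dec (a ≼ω b)
a       ≼ω? []      = yes (a , refl)
[]      ≼ω? (y ∷ b) = no λ ()
(x ∷ a) ≼ω? (y ∷ b) with x ℕ.≟ y | a ≼ω? b
... | yes refl | yes (c , eq) = yes (c , cong (x ∷_) eq)
... | yes refl | no a⋠b       = no λ { (c , refl) → a⋠b (c , refl) }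
... | no x≢y   | _            = no λ { (_ , refl) → x≢y refl }

++-∷-≺ω : ∀ a y d → (a ++ y ∷ d) ≺ω a
++-∷-≺ω a y d = (y ∷ d , refl) , xs++y∷ys≢xs a y d

≺ω⇒length< : ∀ {a b} → a ≺ω b → length b < length a
≺ω⇒length< {b = b} (([]    , refl) , a≢b) = ⊥-elim (a≢b (++-identityʳ b))
≺ω⇒length< {b = b} ((x ∷ c , refl) , _)   =
  subst (length b <_) (sym (length-++-sucʳ b x c)) (s≤s (length-++-≤ˡ b))

-- ℕ* ordered by extension is a tree

prefixes : List ℕ → List (List ℕ)
prefixes []       = [] ∷ []
prefixes (x ∷ xs) = [] ∷ map (x ∷_) (prefixes xs)

∈-prefixes⁻ : ∀ a b → b ∈ prefixes a → a ≼ω b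
∈-prefixes⁻ []      _ (here refl) = [] , refl
∈-prefixes⁻ (x ∷ a) _ (here refl) = x ∷ a , refl
∈-prefixes⁻ (x ∷ a) b (there b∈)  with ∈-map⁻ (x ∷_) b∈
... | b′ , b′∈ , refl = Product.map₂ (cong (x ∷_)) (∈-prefixes⁻ a b′ b′∈)

∈-prefixes⁺ : ∀ a b → a ≼ω b → b ∈ prefixes a
∈-prefixes⁺ []      []      _        = here refl
∈-prefixes⁺ (_ ∷ _) []      _        = here refl
∈-prefixes⁺ _       (y ∷ b) (c , refl) = there (∈-map⁺ (y ∷_) (∈-prefixes⁺ (b ++ c) b (c , refl)))

module ℕ*Tree (_#′_ : List ℕ → List ℕ → Set) where
  open Raw _#′_ _≼ω_

  ∷ʳ-immSucc : ∀ c x → ImmSucc (c ∷ʳ x) c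
  ∷ʳ-immSucc c x = ++-∷-≺ω c x [] , λ y (c∷ʳx≺y , y≺c) →
    ℕ.<⇒≱ (≺ω⇒length< y≺c) (ℕ.m<1+n⇒m≤n (subst (length y <_) length-∷ʳ (≺ω⇒length< c∷ʳx≺y)))
    where
    length-∷ʳ : length (c ∷ʳ x) ≡ suc (length c)
    length-∷ʳ = trans (length-++ c) (ℕ.+-comm (length c) 1)

  immSucc⇒∷ʳ : ∀ {b c} → ImmSucc b c → ∃ λ x → b ≡ c ∷ʳ x
  immSucc⇒∷ʳ {c = c} ((([]         , refl) , b≢c) , _) = ⊥-elim (b≢c (++-identityʳ c))
  immSucc⇒∷ʳ         ((((x ∷ [])    , refl) , _)   , _) = x , refl
  immSucc⇒∷ʳ {c = c} ((((x ∷ y ∷ d) , refl) , _)   , nothingBetween) =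
    ⊥-elim (nothingBetween (c ∷ʳ x)
      (subst (_≺ω (c ∷ʳ x)) (++-assoc c [ x ] (y ∷ d)) (++-∷-≺ω (c ∷ʳ x) y d) , ++-∷-≺ω c x []))

  chainFrom : List ℕ → List ℕ → List (List ℕ)
  chainFrom c []      = []
  chainFrom c (x ∷ d) = c ∷ʳ x ∷ chainFrom (c ∷ʳ x) d

  chainTo-chainFrom : ∀ c d → ChainTo c (c ++ d) (chainFrom c d)
  chainTo-chainFrom c []      = subst (λ a → ChainTo c a []) (sym (++-identityʳ c)) here
  chainTo-chainFrom c (x ∷ d) =
    step (∷ʳ-immSucc c x)
         (subst (λ a → ChainTo (c ∷ʳ x) a (chainFrom (c ∷ʳ x) d)) (++-assoc c [ x ] d)
                (chainTo-chainFrom (c ∷ʳ x) d))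

  chainTo-≼ω : ∀ {c a l} → ChainTo c a l → a ≼ω c
  chainTo-≼ω here              = ≼ω-refl
  chainTo-≼ω (step b⋖c chain) = ≼ω-trans (chainTo-≼ω chain) (proj₁ (proj₁ b⋖c))

  chainTo-unique : ∀ {c a l} → ChainTo c a l → ∀ d → a ≡ c ++ d → l ≡ chainFrom c d
  chainTo-unique {c} here d eq with ++-identityʳ-unique c eq
  ... | refl = refl
  chainTo-unique {c} (step b⋖c chain) d eq with immSucc⇒∷ʳ b⋖c | chainTo-≼ω chain
  ... | x , refl | r , refl with ++-cancelˡ c _ _ (trans (sym (++-assoc c [ x ] r)) eq)
  ... | refl = cong (c ∷ʳ x ∷_) (chainTo-unique chain r refl)

  ℕ*-isTree : IsTree []
  ℕ*-isTree = (λ a → prefixes a , λ b → mk⇔ (∈-prefixes⁻ a b) (∈-prefixes⁺ a b))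
            , λ a → chainFrom [] a , chainTo-chainFrom [] a , λ l chain → chainTo-unique chain a refl

module PreNaturalProperties (S : PreNatural) where
  open PreNatural S

  ≼-#ˡ : ∀ {a b c} → a ≼ b → b # c → a # c
  ≼-#ˡ a≼b b#c = #-sym (≼-# a≼b (#-sym b#c))

  ≼⇒¬# : ∀ {a b} → a ≼ b → ¬ (b # a)
  ≼⇒¬# a≼b b#a = #-irrefl (≼-# a≼b (#-sym b#a))

  ≺-≼-trans : ∀ {a b c} → a ≺ b → b ≼ c → a ≺ c
  ≺-≼-trans = Strict.<-≤-trans _≡_ _≼_ sym ≼-trans ≼-antisym λ { refl r → r }

  ≼-≺-trans : ∀ {a b c} → a ≼ b → b ≺ c → a ≺ c
  ≼-≺-trans = Strict.≤-<-trans _≡_ _≼_ ≼-trans ≼-antisym λ { refl r → r }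

  point-antitone : ∀ {p} → IsPoint p → ∀ {m n} → m ≤ n → p n ≼ p m
  point-antitone {p} p-point = stepwise⇒antitone {R = _≼_} ≼-refl ≼-trans p (proj₁ p-point)

  consIfNew-All : ∀ {Q : V → Set} {a} t → Q a → All Q t → All Q (consIfNew a t)
  consIfNew-All []      qa _  = qa ∷ []
  consIfNew-All {a = a} (b ∷ t) qa qt with a ≟ b
  ... | yes _ = qt
  ... | no  _ = qa ∷ qt

  consIfNew-strict : ∀ {a} t → All (a ≼_) t → AllPairs _≺_ t → AllPairs _≺_ (consIfNew a t)
  consIfNew-strict []      _ _ = [] ∷ []
  consIfNew-strict {a} (b ∷ t) (a≼b ∷ _) (b≺t ∷ t-strict) with a ≟ b
  ... | yes _   = b≺t ∷ t-strict
  ... | no  a≢b = (a≺b ∷ All.map (λ b≺ → ≺-≼-trans a≺b (proj₁ b≺)) b≺t) ∷ b≺t ∷ t-strict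
    where a≺b = a≼b , a≢b

  module _ {p : ℕ → V} (p-step : ∀ n → p (suc n) ≼ p n) where
    trailOf-≽ : ∀ n → All (p n ≼_) (trailOf p n)
    trailOf-≽ zero    = []
    trailOf-≽ (suc n) = consIfNew-All (trailOf p n) (p-step n) (All.map (≼-trans (p-step n)) (trailOf-≽ n))

    trailOf-strict : ∀ n → AllPairs _≺_ (trailOf p n)
    trailOf-strict zero    = []
    trailOf-strict (suc n) = consIfNew-strict (trailOf p n) (trailOf-≽ n) (trailOf-strict n)

  trailDot-strict : ∀ {t} → IsTrailDot t → AllPairs _≺_ t
  trailDot-strict (p , p-point , n , refl) = trailOf-strict (proj₁ p-point) n

  newest-≼ : ∀ {y s} → AllPairs _≺_ (y ∷ s) → All (y ≼_) (y ∷ s)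
  newest-≼ (y≺s ∷ _) = ≼-refl ∷ All.map proj₁ y≺s

  newest-# : ∀ {y t a} → All (y ≼_) t → t #ᵗ [ a ] → y # a
  newest-# (y≼x ∷ _) x#a = ≼-#ˡ y≼x x#a

  ≼ᵗ-refl : ∀ {t} → t ≼ᵗ t
  ≼ᵗ-refl = [] , refl

  ≼ᵗ-trans : ∀ {t s r} → t ≼ᵗ s → s ≼ᵗ r → t ≼ᵗ r
  ≼ᵗ-trans {r = r} (c , refl) (d , refl) = c ++ d , sym (++-assoc c d r)

  ≼ᵗ-antisym : ∀ {t s} → t ≼ᵗ s → s ≼ᵗ t → t ≡ s
  ≼ᵗ-antisym {s = s} (c , refl) (d , eq)
    with ++-conicalʳ d c (++-identityˡ-unique (d ++ c) (trans eq (sym (++-assoc d c s))))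
  ... | refl = refl

  ≼ᵗ-≺ᵗ-trans : ∀ {t s r} → t ≼ᵗ s → s Trail.≺ r → t Trail.≺ r
  ≼ᵗ-≺ᵗ-trans = Strict.≤-<-trans _≡_ _≼ᵗ_ ≼ᵗ-trans ≼ᵗ-antisym λ { refl r → r }

  ≺ᵗ⇒∷ : ∀ {t s} → t Trail.≺ s → ∃ λ y → ∃ λ c → t ≡ y ∷ c ++ s
  ≺ᵗ⇒∷ (([]    , refl) , t≢s) = ⊥-elim (t≢s refl)
  ≺ᵗ⇒∷ ((y ∷ c , refl) , _)   = y , c , refl

module Spread (S : PreNatural) (nat : PreNatural.IsNatural S) where
  open PreNatural S
  open PreNaturalProperties S

  ⊤ : V
  ⊤ = proj₁ (proj₁ nat)

  ≼⊤ : ∀ a → a ≼ ⊤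
  ≼⊤ = proj₂ (proj₁ nat)

  enum : ℕ → V
  enum = proj₁ countable

  index : V → ℕ
  index a = proj₁ (proj₂ countable a)

  enum-index : ∀ a → enum (index a) ≡ a
  enum-index a = proj₂ (proj₂ countable a)

  pairˡ pairʳ : ℕ → V
  pairˡ k = enum (proj₁ (unpair k))
  pairʳ k = enum (proj₂ (unpair k))

  pair-surjective : ∀ a b → ∃ λ k → pairˡ k ≡ a × pairʳ k ≡ b
  pair-surjective a b =
    let k , uk = unpair-surjective (index a) (index b)
    in k , trans (cong (enum ∘ proj₁) uk) (enum-index a) , trans (cong (enum ∘ proj₂) uk) (enum-index b)

  Separates : ℕ → V → Set
  Separates k y = pairˡ k # pairʳ k → (y # pairˡ k) ⊎ (y # pairʳ k)

  Separates-≼ : ∀ {k x y} → x ≼ y → Separates k y → Separates k x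
  Separates-≼ x≼y y-sep apart = Sum.map (≼-#ˡ x≼y) (≼-#ˡ x≼y) (y-sep apart)

  Admissible : V → ℕ → V → Set
  Admissible c k x = x ≺ c × Separates k x

  admissible? : ∀ c k x → Dec (Admissible c k x)
  admissible? c k x =
    (≼-dec x c ×-dec ¬? (x ≟ c))
    ×-dec (#-dec (pairˡ k) (pairʳ k) →-dec (#-dec x (pairˡ k) ⊎-dec #-dec x (pairʳ k)))

  -- Go down into ĉ along one of its points until the point separates the k-th pair.
  admissible-exists : ∀ c k → Σ V (Admissible c k)
  admissible-exists c k with proj₂ nat c
  ... | p , p-point , m₀ , pm₀≺c with #-dec (pairˡ k) (pairʳ k)
  ... | no ¬apart = p m₀ , pm₀≺c , λ apart → ⊥-elim (¬apart apart)
  ... | yes apart with proj₂ (proj₂ p-point) _ _ apart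
  ... | m₁ , sep =
    p (m₁ + m₀) , ≼-≺-trans (point-antitone p-point (ℕ.m≤n+m m₀ m₁)) pm₀≺c
                , Separates-≼ {k} (point-antitone p-point (ℕ.m≤m+n m₁ m₀)) (λ _ → sep)

  -- Decoding ℕ* into paths of admissible dots

  child : V → ℕ → ℕ → V
  child c k n with admissible? c k (enum n)
  ... | yes _ = enum n
  ... | no  _ = proj₁ (admissible-exists c k)

  child-admissible : ∀ c k n → Admissible c k (child c k n)
  child-admissible c k n with admissible? c k (enum n)
  ... | yes adm = adm
  ... | no  _   = proj₂ (admissible-exists c k)

  child-index : ∀ c k x → Admissible c k x → child c k (index x) ≡ x
  child-index c k x adm with admissible? c k (enum (index x))
  ... | yes _   = enum-index x
  ... | no ¬adm = ⊥-elim (¬adm (subst (Admissible c k) (sym (enum-index x)) adm))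

  decodeFrom : V → ℕ → List ℕ → V
  decodeFrom c k []      = c
  decodeFrom c k (n ∷ u) = decodeFrom (child c k n) (suc k) u

  decode : List ℕ → V
  decode = decodeFrom ⊤ 0

  decodeFrom-++ : ∀ c k u w → decodeFrom c k (u ++ w) ≡ decodeFrom (decodeFrom c k u) (k + length u) w
  decodeFrom-++ c k []      w = cong (λ i → decodeFrom c i w) (sym (ℕ.+-identityʳ k))
  decodeFrom-++ c k (n ∷ u) w =
    trans (decodeFrom-++ (child c k n) (suc k) u w)
          (cong (λ i → decodeFrom (decodeFrom (child c k n) (suc k) u) i w) (sym (ℕ.+-suc k (length u))))

  decode-∷ʳ : ∀ u n → decode (u ∷ʳ n) ≡ child (decode u) (length u) n
  decode-∷ʳ u n = decodeFrom-++ ⊤ 0 u [ n ]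

  decodeFrom-≼ : ∀ c k w → decodeFrom c k w ≼ c
  decodeFrom-≼ c k []      = ≼-refl
  decodeFrom-≼ c k (n ∷ w) = ≼-trans (decodeFrom-≼ _ _ w) (proj₁ (proj₁ (child-admissible c k n)))

  decode-≼ : ∀ {a b} → a ≼ω b → decode a ≼ decode b
  decode-≼ {b = b} (c , refl) = subst (_≼ decode b) (sym (decodeFrom-++ ⊤ 0 b c)) (decodeFrom-≼ _ _ c)

  decode-≺ : ∀ {a b} → a ≺ω b → decode a ≺ decode b
  decode-≺ {b = b} (([]    , refl) , a≢b) = ⊥-elim (a≢b (++-identityʳ b))
  decode-≺ {b = b} ((n ∷ c , refl) , _)   =
    subst (_≺ decode b) (sym (decodeFrom-++ ⊤ 0 b (n ∷ c)))
          (≼-≺-trans (decodeFrom-≼ _ _ c) (proj₁ (child-admissible (decode b) (length b) n)))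

  decode-separates : ∀ K w → K < length w → Separates K (decode w)
  decode-separates K w K< with splitAt-<length K w K<
  ... | u , n , w′ , refl , refl =
    subst (Separates (length u)) (sym (decodeFrom-++ ⊤ 0 u (n ∷ w′)))
          (Separates-≼ {length u} (decodeFrom-≼ _ _ w′) (proj₂ (child-admissible (decode u) (length u) n)))

  unbounded : ∀ (q : ℕ → List ℕ) → (∀ n → ∃ λ m → q m ≺ω q n) → ∀ K → ∃ λ m → K < length (q m)
  unbounded q desc zero with desc 0
  ... | m , q≺ = m , ℕ.≤-trans (s≤s z≤n) (≺ω⇒length< q≺)
  unbounded q desc (suc K) with unbounded q desc K
  ... | m′ , K< with desc m′
  ... | m , q≺ = m , ℕ.≤-trans (s≤s K<) (≺ω⇒length< q≺)

  decode-separates-eventually : ∀ (q : ℕ → List ℕ) → (∀ n → ∃ λ m → q m ≺ω q n) →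
    ∀ a b → a # b → ∃ λ m → (decode (q m) # a) ⊎ (decode (q m) # b)
  decode-separates-eventually q desc a b a#b with pair-surjective a b
  ... | K , refl , refl with unbounded q desc K
  ... | m , K< = m , decode-separates K (q m) K< a#b

  -- Greedy encoding of trails (newest dot first)

  extend : List ℕ → V → List ℕ
  extend u x with admissible? (decode u) (length u) x
  ... | yes _ = u ∷ʳ index x
  ... | no  _ = u

  encode : List V → List ℕ
  encode []      = []
  encode (x ∷ t) = extend (encode t) x

  extend-≼ω : ∀ u x → extend u x ≼ω u
  extend-≼ω u x with admissible? (decode u) (length u) x
  ... | yes _ = [ index x ] , refl
  ... | no  _ = ≼ω-refl

  extend-admissible : ∀ u x → Admissible (decode u) (length u) x → extend u x ≡ u ∷ʳ index x
  extend-admissible u x adm with admissible? (decode u) (length u) x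
  ... | yes _   = refl
  ... | no ¬adm = ⊥-elim (¬adm adm)

  decode-extend : ∀ (Q : V → Set) u x → Q (decode u) → Q x → Q (decode (extend u x))
  decode-extend Q u x qu qx with admissible? (decode u) (length u) x
  ... | yes adm = subst Q (sym (trans (decode-∷ʳ u (index x)) (child-index _ _ x adm))) qx
  ... | no  _   = qu

  decode-encode : ∀ (Q : V → Set) t → Q ⊤ → All Q t → Q (decode (encode t))
  decode-encode Q []      q⊤ []        = q⊤
  decode-encode Q (x ∷ t) q⊤ (qx ∷ qt) = decode-extend Q (encode t) x (decode-encode Q t q⊤ qt) qx

  encode-++ : ∀ c s → encode (c ++ s) ≼ω encode s
  encode-++ []      s = ≼ω-refl
  encode-++ (x ∷ c) s = ≼ω-trans (extend-≼ω (encode (c ++ s)) x) (encode-++ c s)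

  encode-≼ω : ∀ {t s} → t ≼ᵗ s → encode t ≼ω encode s
  encode-≼ω (c , refl) = encode-++ c _

  encode-grows : ∀ y s t → s ≼ᵗ t → Admissible (decode (encode t)) (length (encode t)) y →
                 encode (y ∷ s) ≢ encode t
  encode-grows y s t s≼t adm eq = xs++y∷ys≢xs (encode s) (index y) [] (trans ext (trans eq (sym same)))
    where
    same : encode s ≡ encode t
    same = ≼ω-antisym (encode-≼ω s≼t) (subst (_≼ω encode s) eq (extend-≼ω (encode s) y))
    ext : encode s ∷ʳ index y ≡ encode (y ∷ s)
    ext = sym (extend-admissible (encode s) y
                (subst (λ u → Admissible (decode u) (length u) y) (sym same) adm))

  newest-≼-decode-encode : ∀ {x t} → IsTrailDot (x ∷ t) → x ≼ decode (encode (x ∷ t))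
  newest-≼-decode-encode dot = decode-encode (_ ≼_) _ (≼⊤ _) (newest-≼ (trailDot-strict dot))

  -- t may be empty, so y ≺ ⊤ has to come from the dot of s just below y.
  newest-≺-decode-encode : ∀ {y s t} → AllPairs _≺_ (y ∷ s) → s Trail.≺ t → y ≺ decode (encode t)
  newest-≺-decode-encode (y≺s ∷ _) s≺t with ≺ᵗ⇒∷ s≺t
  ... | z , c , refl = decode-encode (_ ≺_) _ (≺-≼-trans (All.head y≺s) (≼⊤ z)) (All.++⁻ʳ (z ∷ c) y≺s)

  trailOf-≼-decode-encode : ∀ {p} → (∀ n → p (suc n) ≼ p n) → ∀ n → p n ≼ decode (encode (trailOf p n))
  trailOf-≼-decode-encode {p} p-step n = decode-encode (p n ≼_) (trailOf p n) (≼⊤ (p n)) (trailOf-≽ p-step n)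

  module TrailPoint (P : ℕ → List V) (P-dots : ∀ n → IsTrailDot (P n)) (P-point : Trail.IsPoint P) where
    P-antitone : ∀ {m n} → m ≤ n → P n ≼ᵗ P m
    P-antitone = stepwise⇒antitone {R = _≼ᵗ_} ≼ᵗ-refl ≼ᵗ-trans P (proj₁ P-point)

    P-strict : ∀ {m y s} → P m ≡ y ∷ s → AllPairs _≺_ (y ∷ s)
    P-strict {m} eq = subst (AllPairs _≺_) eq (trailDot-strict (P-dots m))

    properlyExtended : ∀ n → ∃ λ m₀ → ∀ {m} → m₀ ≤ m → ∃ λ y → ∃ λ s → P m ≡ y ∷ s × s Trail.≺ P n
    properlyExtended n with proj₁ (proj₂ P-point) n
    ... | m₁ , P₁≺ with proj₁ (proj₂ P-point) m₁
    ... | m₀ , P₀≺ = m₀ , λ m₀≤m →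
      let y , c , eq = ≺ᵗ⇒∷ (≼ᵗ-≺ᵗ-trans (P-antitone m₀≤m) P₀≺)
      in y , c ++ P m₁ , eq , ≼ᵗ-≺ᵗ-trans (c , refl) P₁≺

    separatedBelow : ∀ n k → ∃ λ m → ∃ λ y → ∃ λ s → P m ≡ y ∷ s × s Trail.≺ P n × Separates k y
    separatedBelow n k with properlyExtended n | #-dec (pairˡ k) (pairʳ k)
    ... | m₀ , ext | no ¬apart =
      let y , s , eq , s≺ = ext ℕ.≤-refl in m₀ , y , s , eq , s≺ , λ apart → ⊥-elim (¬apart apart)
    ... | m₀ , ext | yes apart with proj₂ (proj₂ P-point) [ pairˡ k ] [ pairʳ k ] apart
    ... | m₁ , sep with ext (ℕ.m≤n+m m₀ m₁) | P-antitone (ℕ.m≤m+n m₁ m₀)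
    ... | y , s , eq , s≺ | c , Pm≡c++P₁ =
      m₁ + m₀ , y , s , eq , s≺ , λ _ → Sum.map (newest-# y≼P₁) (newest-# y≼P₁) sep
      where
      y≼P₁ : All (y ≼_) (P m₁)
      y≼P₁ = All.++⁻ʳ c (subst (All (y ≼_)) (trans (sym eq) Pm≡c++P₁) (newest-≼ (P-strict eq)))

    encode-descends : ∀ n → ∃ λ m → encode (P m) ≺ω encode (P n)
    encode-descends n with separatedBelow n (length (encode (P n)))
    ... | m , y , s , eq , s≺Pn , sep = m , subst (_≺ω encode (P n)) (cong encode (sym eq)) (y∷s≼ , y∷s≢)
      where
      y∷s≼ : encode (y ∷ s) ≼ω encode (P n)
      y∷s≼ = ≼ω-trans (extend-≼ω (encode s) y) (encode-≼ω (proj₁ s≺Pn))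
      y∷s≢ : encode (y ∷ s) ≢ encode (P n)
      y∷s≢ = encode-grows y s (P n) (proj₁ s≺Pn)
               (newest-≺-decode-encode (P-strict eq) s≺Pn , sep)

  -- The spread on ℕ*

  _#′_ : List ℕ → List ℕ → Set
  u #′ w = decode u # decode w

  isPreNatural′ : IsPreNatural _#′_ _≼ω_
  isPreNatural′ = record
    { countable = ℕ*-countable
    ; #-dec     = λ a b → #-dec (decode a) (decode b)
    ; ≼-dec     = _≼ω?_
    ; #-sym     = #-sym
    ; #-irrefl  = #-irrefl
    ; ≼-refl    = ≼ω-refl
    ; ≼-trans   = ≼ω-trans
    ; ≼-antisym = ≼ω-antisym
    ; ≼-#       = λ a≼b c#b → ≼-# (decode-≼ a≼b) c#b
    }

  N : PreNatural
  N = ℕ*Space _#′_ isPreNatural′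

  module N = PreNatural N

  descending⇒point : ∀ (q : ℕ → List ℕ) → (∀ n → q (suc n) ≼ω q n) → (∀ n → ∃ λ m → q m ≺ω q n) → N.IsPoint q
  descending⇒point q q-step desc = q-step , desc , λ a b → decode-separates-eventually q desc (decode a) (decode b)

  strictDecIsPoint : N.StrictDecIsPoint
  strictDecIsPoint s s≺ = descending⇒point s (proj₁ ∘ s≺) (λ n → suc n , s≺ n)

  zerosAfter : List ℕ → ℕ → List ℕ
  zerosAfter a zero    = a ∷ʳ 0
  zerosAfter a (suc n) = zerosAfter a n ∷ʳ 0

  N-isNatural : N.IsNatural
  N-isNatural = ([] , λ a → a , refl)
              , λ a → zerosAfter a , strictDecIsPoint (zerosAfter a) (λ n → ++-∷-≺ω (zerosAfter a n) 0 [])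
                                   , 0 , ++-∷-≺ω a 0 []

  N-isSpread : N.IsSpread N-isNatural
  N-isSpread = ℕ*Tree.ℕ*-isTree _#′_ , strictDecIsPoint

  decode-isRefinement : IsRefinementMorphism N S decode
  decode-isRefinement = record
    { #-reflect  = λ _ _ h → h
    ; ≼-preserve = λ _ _ → decode-≼
    ; points     = λ q (q-step , desc , _) →
        (λ n → decode-≼ (q-step n)) , (λ n → Product.map₂ decode-≺ (desc n)) , decode-separates-eventually q desc
    }

  encode-reflects-# : ∀ t s → IsTrailDot t → IsTrailDot s → encode t #′ encode s → t #ᵗ s
  encode-reflects-# []      _       _      _      h = ≼⇒¬# (≼⊤ _) h
  encode-reflects-# (_ ∷ _) []      _      _      h = ≼⇒¬# (≼⊤ _) (#-sym h)
  encode-reflects-# (_ ∷ _) (_ ∷ _) t-dot s-dot h =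
    ≼-# (newest-≼-decode-encode s-dot) (≼-#ˡ (newest-≼-decode-encode t-dot) h)

  encode-isTrailMorphism : IsTrailMorphism S N encode
  encode-isTrailMorphism = record
    { #-reflect  = encode-reflects-#
    ; ≼-preserve = λ _ _ _ _ → encode-≼ω
    ; points     = λ P P-dots P-point →
        descending⇒point (encode ∘ P) (λ n → encode-≼ω (proj₁ P-point n)) (TrailPoint.encode-descends P P-dots P-point)
    }

  S≅N : Iso S N
  S≅N = inj₂ (encode , encode-isTrailMorphism) , inj₁ (decode , decode-isRefinement)
      , (λ p p-point (n , h) → ≼⇒¬# (trailOf-≼-decode-encode (proj₁ p-point) n) h)
      , (λ q q-point (n , h) → ≼⇒¬# (trailOf-≼-decode-encode (decode-≼ ∘ proj₁ q-point) n) h)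

mainTheorem6 : (S : PreNatural) → PreNatural.IsNatural S →
    Σ (List ℕ → List ℕ → Set) λ _#′_ →
    Σ (IsPreNatural _#′_ _≼ω_) λ ax →
    Σ (PreNatural.IsNatural (ℕ*Space _#′_ ax)) λ nat →
      PreNatural.IsSpread (ℕ*Space _#′_ ax) nat × Iso S (ℕ*Space _#′_ ax)
mainTheorem6 S nat = _#′_ , isPreNatural′ , N-isNatural , N-isSpread , S≅N
  where open Spread S nat
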